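{- For all $L,M\in\{0,1,2,\dots\}$, $$\sum_{j=-\infty}^{\infty}q^{j(j+1)}\bigl\{\mathcal{T}(L,M,2j,j)-\mathcal{T}(L,M,2j+2,j)\bigr\}=\delta_{L,0}\,\delta_{M,0}.$$
   Context: The Gaussian polynomial is $\left[\begin{smallmatrix}m+n\\ m\end{smallmatrix}\right]=\prod_{k=1}^m\frac{1-q^{n+k}}{1-q^k}$ if $m,n\in\{0,1,2,\dots\}$ and $0$ otherwise. For integers $L,M,a,b$ the refined $q$-trinomial coefficient is $$\mathcal{T}(L,M,a,b)=\sum_{\substack{n=0\\ n+a+L\ \text{even}}}^{L} q^{\frac12 n^2}\begin{bmatrix}M\\ n\end{bmatrix}\begin{bmatrix}M+b+(L-a-n)/2\\ M+b\end{bmatrix}\begin{bmatrix}M-b+(L+a-n)/2\\ M-b\end{bmatrix}.$$ -}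

module Defs where

open import Data.Nat as ℕ using (ℕ; zero; suc; _%_; _≡ᵇ_)
open import Data.Integer as ℤ using (ℤ; +_; -[1+_]; 0ℤ; 1ℤ; _+_; _-_; _*_; -_; ∣_∣)
open import Data.List using (List; []; _∷_; map; foldr; upTo)
open import Data.Bool using (Bool; true; false; if_then_else_; _∧_)
open import Relation.Binary.PropositionalEquality using (_≡_)

-- Formal power series in t = q^(1/2) with integer coefficients,
-- represented by their coefficient functions (coefficient of t^e).
Series : Set
Series = ℕ → ℤ

zeroS : Series
zeroS _ = 0ℤ

oneS : Series
oneS zero    = 1ℤ
oneS (suc _) = 0ℤ

mono : ℕ → Series
mono d e = if d ≡ᵇ e then 1ℤ else 0ℤ

addS : Series → Series → Series
addS f g e = f e + g e

subS : Series → Series → Series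
subS f g e = f e - g e

sumℤ : List ℤ → ℤ
sumℤ = foldr _+_ 0ℤ

mulS : Series → Series → Series
mulS f g e = sumℤ (map (λ i → f i * g (e ℕ.∸ i)) (upTo (suc e)))

sumS : List Series → Series
sumS = foldr addS zeroS

prodS : List Series → Series
prodS = foldr mulS oneS

oneMinusQ : ℕ → Series
oneMinusQ d = subS oneS (mono (2 ℕ.* d))

-- 1 / (1 - q^(suc k)) = Σ_i t^(2 (suc k) i)
geomQ : ℕ → Series
geomQ k e = if (e % (2 ℕ.* suc k)) ≡ᵇ 0 then 1ℤ else 0ℤ

-- Gaussian polynomial [m+n ; m] = ∏_{k=1}^m (1 - q^(n+k)) / (1 - q^k), m n ∈ ℕ
gaussNat : ℕ → ℕ → Series
gaussNat m n =
  mulS (prodS (map (λ k → oneMinusQ (n ℕ.+ suc k)) (upTo m)))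
       (prodS (map geomQ (upTo m)))

gauss : ℤ → ℤ → Series
gauss A B with B | A - B
... | + m | + n = gaussNat m n
... | _   | _   = zeroS

-- parity test and halving (used only on even integers)
isEven : ℤ → Bool
isEven z = (∣ z ∣ % 2) ≡ᵇ 0

half : ℤ → ℤ
half (+ n)      = + (n ℕ./ 2)
half -[1+ n ]   = - (+ (suc n ℕ./ 2))

range0 : ℤ → List ℕ
range0 (+ l)    = upTo (suc l)
range0 -[1+ _ ] = []

T : ℤ → ℤ → ℤ → ℤ → Series
T L M a b = sumS (map summand (range0 L))
  where
  summand : ℕ → Series
  summand n =
    if isEven (+ n + a + L)
    then mulS (mono (n ℕ.* n))                    -- q^(n²/2) = t^(n²)
           (mulS (gauss M (+ n))
             (mulS (gauss (M + b + half (L - a - + n)) (M + b))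
                   (gauss (M - b + half (L + a - + n)) (M - b))))
    else zeroS

summandJ : ℕ → ℕ → ℤ → Series
summandJ L M j =
  mulS (mono (2 ℕ.* ∣ j * (j + 1ℤ) ∣))
       (subS (T (+ L) (+ M) (+ 2 * j) j) (T (+ L) (+ M) (+ 2 * j + + 2) j))

rangeℤ : ℕ → ℕ → List ℤ
rangeℤ K₁ K₂ = map (λ i → + i - + K₁) (upTo (suc (K₁ ℕ.+ K₂)))

partialSum : (ℤ → Series) → ℕ → ℕ → Series
partialSum f K₁ K₂ = sumS (map f (rangeℤ K₁ K₂))

-- bilateral sum Σ_{j∈ℤ} f j converges (t-adically, i.e. coefficientwise) to s
SumsTo : (ℤ → Series) → Series → Set
SumsTo f s = ∀ e → Σ ℕ λ N → ∀ K₁ K₂ → N ℕ.≤ K₁ → N ℕ.≤ K₂ → partialSum f K₁ K₂ e ≡ s e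
  where open import Data.Product using (Σ)

deltaS : ℕ → ℕ → Series
deltaS zero zero = oneS
deltaS _    _    = zeroS

-- Fix n. The n-th summands of T(L,M,2j,j) and T(L,M,2j+2,j) vanish unless L − n = 2K is even,
-- and then they are q^(n²/2) [M; n] times [P; M+j][P; M−j], resp. [P−1; M+j][P+1; M−j], where
-- P = M + K. Expanding [P; M+j] and [P+1; M−j] by Pascal's rule shows that for P > 0 the j-th term
-- q^(j(j+1)) ([P; M+j][P; M−j] − [P−1; M+j][P+1; M−j]) equals q^K (B(j−1) − B(j)) with
-- B(j) = q^((j+1)²) [P−1; M+j][P; M−j−1]. Hence the sum over j telescopes, to 0 as soon as the
-- range of j contains [−M, M], where B vanishes at both ends; for P = 0, i.e. M = K = 0, the
-- same telescoping gives 1. As [0; n] = 0 for n > 0, only L = M = 0 survives. In particular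
-- every partial sum over a range containing [−M, M] is already equal to δ_{L,0} δ_{M,0}.

module Submission where

open import Defs
open import Data.Nat as ℕ using (ℕ; zero; suc; _∸_; _≡ᵇ_)
open import Data.Bool using (true; false; if_then_else_)
open import Data.Integer as ℤ using (ℤ; +_; -[1+_]; 0ℤ; 1ℤ; _+_; _-_; _*_; -_; ∣_∣)
import Data.Integer.Properties as ℤP
import Data.Sign as Sign
import Data.Sign.Properties as SignP
open import Data.Integer.Tactic.RingSolver using (solve-∀)
open import Data.Fin using (Fin; toℕ; opposite)
open import Data.Fin.Properties using (opposite-prop; toℕ≤pred[n]; toℕ<n; toℕ-inject₁; toℕ-fromℕ)
import Data.Fin.Permutation as Permutation
import Data.Nat.Properties as ℕP
import Data.Nat.DivMod as ℕD
import Data.Vec.Functional as Vector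
open import Data.List using (foldr; map; applyUpTo; upTo)
import Data.List.Properties as ListP
open import Data.Maybe using (Maybe; just; nothing)
open import Relation.Nullary using (yes; no)
open import Relation.Binary.Definitions using (tri<; tri≈; tri>)
open import Data.Product using (Σ; _,_)
open import Data.Sum using (_⊎_; inj₁; inj₂)
open import Data.Empty using (⊥; ⊥-elim)
open import Function using (_∘_)
open import Level using (0ℓ)
open import Algebra.Bundles using (CommutativeRing)
import Algebra.Properties.CommutativeMonoid.Sum as CommutativeMonoidSum
import Algebra.Properties.Semiring.Sum as SemiringSum
import Algebra.Solver.Ring.AlmostCommutativeRing as ACR
open import Relation.Binary.PropositionalEquality

infixl 6 _⊕_ _⊖_
infixl 7 _⊛_
infix 8 ⊝_

_⊕_ _⊖_ _⊛_ : Series → Series → Series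
_⊕_ = addS
_⊖_ = subS
_⊛_ = mulS

⊝_ : Series → Series
(⊝ f) e = - f e

foldr-map-applyUpTo : ∀ {A B : Set} (_∙_ : B → B → B) (ε : B) (h : A → B) (g : ℕ → A) n →
  foldr _∙_ ε (map h (applyUpTo g n)) ≡ Vector.foldr _∙_ ε (λ (i : Fin n) → h (g (toℕ i)))
foldr-map-applyUpTo _∙_ ε h g zero    = refl
foldr-map-applyUpTo _∙_ ε h g (suc n) = cong (h (g 0) ∙_) (foldr-map-applyUpTo _∙_ ε h (g ∘ suc) n)

module ℤΣ where
  open CommutativeMonoidSum ℤP.+-0-commutativeMonoid public
  open SemiringSum ℤP.+-*-semiring public using (*-distribˡ-sum)
open ℤΣ using (sum-syntax)

module CauchyProduct where
  open ≡-Reasoning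

  coefficient : ∀ f g e → (f ⊛ g) e ≡ ∑[ i < suc e ] (f (toℕ i) * g (e ∸ toℕ i))
  coefficient f g e = foldr-map-applyUpTo _+_ 0ℤ (λ i → f i * g (e ∸ i)) (λ i → i) (suc e)

  coefficient-zero : ∀ f g → (f ⊛ g) 0 ≡ f 0 * g 0
  coefficient-zero f g = ℤP.+-identityʳ (f 0 * g 0)

  coefficient-suc : ∀ f g e → (f ⊛ g) (suc e) ≡ f 0 * g (suc e) + ((f ∘ suc) ⊛ g) e
  coefficient-suc f g e = trans (coefficient f g (suc e)) (cong (_+_ (f 0 * g (suc e))) (sym (coefficient (f ∘ suc) g e)))

  congˡ : ∀ {f f′} g → f ≗ f′ → f ⊛ g ≗ f′ ⊛ g
  congˡ {f} {f′} g f≗f′ e = begin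
    (f ⊛ g) e
      ≡⟨ coefficient f g e ⟩
    ∑[ i < suc e ] (f (toℕ i) * g (e ∸ toℕ i))
      ≡⟨ ℤΣ.sum-cong-≗ {suc e} (λ i → cong (_* g (e ∸ toℕ i)) (f≗f′ (toℕ i))) ⟩
    ∑[ i < suc e ] (f′ (toℕ i) * g (e ∸ toℕ i))
      ≡⟨ coefficient f′ g e ⟨
    (f′ ⊛ g) e ∎

  comm : ∀ f g → f ⊛ g ≗ g ⊛ f
  comm f g e = begin
    (f ⊛ g) e
      ≡⟨ coefficient f g e ⟩
    ∑[ i < suc e ] (f (toℕ i) * g (e ∸ toℕ i))
      ≡⟨ ℤΣ.∑-permute (λ i → f (toℕ i) * g (e ∸ toℕ i)) Permutation.reverse ⟩
    ∑[ i < suc e ] (f (toℕ (opposite i)) * g (e ∸ toℕ (opposite i)))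
      ≡⟨ ℤΣ.sum-cong-≗ {suc e} reindex ⟩
    ∑[ i < suc e ] (g (toℕ i) * f (e ∸ toℕ i))
      ≡⟨ coefficient g f e ⟨
    (g ⊛ f) e ∎
    where
    reindex : ∀ (i : Fin (suc e)) → f (toℕ (opposite i)) * g (e ∸ toℕ (opposite i)) ≡ g (toℕ i) * f (e ∸ toℕ i)
    reindex i rewrite opposite-prop i | ℕP.m∸[m∸n]≡n (toℕ≤pred[n] i) = ℤP.*-comm (f (e ∸ toℕ i)) (g (toℕ i))

  zeroˡ : ∀ g → zeroS ⊛ g ≗ zeroS
  zeroˡ g e = begin
    (zeroS ⊛ g) e
      ≡⟨ coefficient zeroS g e ⟩
    ∑[ i < suc e ] (0ℤ * g (e ∸ toℕ i))
      ≡⟨ ℤΣ.sum-replicate-zero (suc e) ⟩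
    0ℤ ∎

  identityˡ : ∀ f → oneS ⊛ f ≗ f
  identityˡ f zero    = trans (coefficient-zero oneS f) (ℤP.*-identityˡ (f 0))
  identityˡ f (suc e) = begin
    (oneS ⊛ f) (suc e)
      ≡⟨ coefficient-suc oneS f e ⟩
    1ℤ * f (suc e) + (zeroS ⊛ f) e
      ≡⟨ cong₂ _+_ (ℤP.*-identityˡ (f (suc e))) (zeroˡ f e) ⟩
    f (suc e) + 0ℤ
      ≡⟨ ℤP.+-identityʳ (f (suc e)) ⟩
    f (suc e) ∎

  distribʳ : ∀ f g h → (f ⊕ g) ⊛ h ≗ f ⊛ h ⊕ g ⊛ h
  distribʳ f g h e = begin
    ((f ⊕ g) ⊛ h) e
      ≡⟨ coefficient (f ⊕ g) h e ⟩
    ∑[ i < suc e ] ((f (toℕ i) + g (toℕ i)) * h (e ∸ toℕ i))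
      ≡⟨ ℤΣ.sum-cong-≗ {suc e} (λ i → ℤP.*-distribʳ-+ (h (e ∸ toℕ i)) (f (toℕ i)) (g (toℕ i))) ⟩
    ∑[ i < suc e ] (f (toℕ i) * h (e ∸ toℕ i) + g (toℕ i) * h (e ∸ toℕ i))
      ≡⟨ ℤΣ.∑-distrib-+ {suc e} (λ i → f (toℕ i) * h (e ∸ toℕ i)) (λ i → g (toℕ i) * h (e ∸ toℕ i)) ⟩
    ∑[ i < suc e ] (f (toℕ i) * h (e ∸ toℕ i)) + ∑[ i < suc e ] (g (toℕ i) * h (e ∸ toℕ i))
      ≡⟨ cong₂ _+_ (coefficient f h e) (coefficient g h e) ⟨
    (f ⊛ h) e + (g ⊛ h) e ∎

  scalarˡ : ∀ c f g → (λ i → c * f i) ⊛ g ≗ λ e → c * (f ⊛ g) e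
  scalarˡ c f g e = begin
    ((λ i → c * f i) ⊛ g) e
      ≡⟨ coefficient (λ i → c * f i) g e ⟩
    ∑[ i < suc e ] (c * f (toℕ i) * g (e ∸ toℕ i))
      ≡⟨ ℤΣ.sum-cong-≗ {suc e} (λ i → ℤP.*-assoc c (f (toℕ i)) (g (e ∸ toℕ i))) ⟩
    ∑[ i < suc e ] (c * (f (toℕ i) * g (e ∸ toℕ i)))
      ≡⟨ ℤΣ.*-distribˡ-sum {suc e} c (λ i → f (toℕ i) * g (e ∸ toℕ i)) ⟨
    c * ∑[ i < suc e ] (f (toℕ i) * g (e ∸ toℕ i))
      ≡⟨ cong (c *_) (coefficient f g e) ⟨
    c * (f ⊛ g) e ∎

  assoc : ∀ f g h → (f ⊛ g) ⊛ h ≗ f ⊛ (g ⊛ h)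
  assoc f g h zero = begin
    ((f ⊛ g) ⊛ h) 0
      ≡⟨ trans (coefficient-zero (f ⊛ g) h) (cong (_* h 0) (coefficient-zero f g)) ⟩
    f 0 * g 0 * h 0
      ≡⟨ ℤP.*-assoc (f 0) (g 0) (h 0) ⟩
    f 0 * (g 0 * h 0)
      ≡⟨ trans (coefficient-zero f (g ⊛ h)) (cong (f 0 *_) (coefficient-zero g h)) ⟨
    (f ⊛ (g ⊛ h)) 0 ∎
  assoc f g h (suc e) = begin
    ((f ⊛ g) ⊛ h) (suc e)
      ≡⟨ coefficient-suc (f ⊛ g) h e ⟩
    (f ⊛ g) 0 * h (suc e) + (((f ⊛ g) ∘ suc) ⊛ h) e
      ≡⟨ cong₂ _+_ (cong (_* h (suc e)) (coefficient-zero f g)) (congˡ h (coefficient-suc f g) e) ⟩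
    f 0 * g 0 * h (suc e) + (((λ i → f 0 * g (suc i)) ⊕ (f ∘ suc) ⊛ g) ⊛ h) e
      ≡⟨ cong (_+_ (f 0 * g 0 * h (suc e))) (distribʳ (λ i → f 0 * g (suc i)) ((f ∘ suc) ⊛ g) h e) ⟩
    f 0 * g 0 * h (suc e) + (((λ i → f 0 * g (suc i)) ⊛ h) e + (((f ∘ suc) ⊛ g) ⊛ h) e)
      ≡⟨ cong (_+_ (f 0 * g 0 * h (suc e))) (cong₂ _+_ (scalarˡ (f 0) (g ∘ suc) h e) (assoc (f ∘ suc) g h e)) ⟩
    f 0 * g 0 * h (suc e) + (f 0 * ((g ∘ suc) ⊛ h) e + ((f ∘ suc) ⊛ (g ⊛ h)) e)
      ≡⟨ regroup (f 0) (g 0) (h (suc e)) (((g ∘ suc) ⊛ h) e) (((f ∘ suc) ⊛ (g ⊛ h)) e) ⟩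
    f 0 * (g 0 * h (suc e) + ((g ∘ suc) ⊛ h) e) + ((f ∘ suc) ⊛ (g ⊛ h)) e
      ≡⟨ cong (λ x → f 0 * x + ((f ∘ suc) ⊛ (g ⊛ h)) e) (coefficient-suc g h e) ⟨
    f 0 * (g ⊛ h) (suc e) + ((f ∘ suc) ⊛ (g ⊛ h)) e
      ≡⟨ coefficient-suc f (g ⊛ h) e ⟨
    (f ⊛ (g ⊛ h)) (suc e) ∎
    where
    regroup : ∀ a b c d x → a * b * c + (a * d + x) ≡ a * (b * c + d) + x
    regroup = solve-∀

-- A record rather than f ≗ g, so that f and g can be recovered from a proof by unification.
infix 4 _≈_
record _≈_ (f g : Series) : Set where
  constructor coeffwise
  field coeff : f ≗ g
open _≈_

seriesCommutativeRing : CommutativeRing 0ℓ 0ℓ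
seriesCommutativeRing = record
  { Carrier = Series ; _≈_ = _≈_ ; _+_ = _⊕_ ; _*_ = _⊛_ ; -_ = ⊝_ ; 0# = zeroS ; 1# = oneS
  ; isCommutativeRing = record
    { isRing = record
      { +-isAbelianGroup = record
        { isGroup = record
          { isMonoid = record
            { isSemigroup = record
              { isMagma = record
                { isEquivalence = record
                  { refl = coeffwise λ _ → refl
                  ; sym = λ p → coeffwise λ e → sym (coeff p e)
                  ; trans = λ p q → coeffwise λ e → trans (coeff p e) (coeff q e) }
                ; ∙-cong = λ p q → coeffwise λ e → cong₂ _+_ (coeff p e) (coeff q e) }
              ; assoc = λ f g h → coeffwise λ e → ℤP.+-assoc (f e) (g e) (h e) }
            ; identity = (λ f → coeffwise λ e → ℤP.+-identityˡ (f e))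
                       , (λ f → coeffwise λ e → ℤP.+-identityʳ (f e)) }
          ; inverse = (λ f → coeffwise λ e → ℤP.+-inverseˡ (f e))
                    , (λ f → coeffwise λ e → ℤP.+-inverseʳ (f e))
          ; ⁻¹-cong = λ p → coeffwise λ e → cong -_ (coeff p e) }
        ; comm = λ f g → coeffwise λ e → ℤP.+-comm (f e) (g e) }
      ; *-cong = λ {f} {f′} {g} {g′} p q → coeffwise λ e →
          trans (CauchyProduct.congˡ g (coeff p) e)
                (trans (CauchyProduct.comm f′ g e) (trans (CauchyProduct.congˡ f′ (coeff q) e) (CauchyProduct.comm g′ f′ e)))
      ; *-assoc = λ f g h → coeffwise (CauchyProduct.assoc f g h)
      ; *-identity = (λ f → coeffwise (CauchyProduct.identityˡ f))
                   , (λ f → coeffwise λ e → trans (CauchyProduct.comm f oneS e) (CauchyProduct.identityˡ f e))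
      ; distrib = (λ f g h → coeffwise λ e → trans (CauchyProduct.comm f (g ⊕ h) e)
                    (trans (CauchyProduct.distribʳ g h f e) (cong₂ _+_ (CauchyProduct.comm g f e) (CauchyProduct.comm h f e))))
                , (λ f g h → coeffwise (CauchyProduct.distribʳ g h f)) }
    ; *-comm = λ f g → coeffwise (CauchyProduct.comm f g) } }

open CommutativeRing seriesCommutativeRing
  using ( +-cong; +-congˡ; +-congʳ; +-identityˡ; +-identityʳ
        ; *-cong; *-congˡ; *-congʳ; *-identityˡ; *-identityʳ; -‿cong; zeroˡ; zeroʳ)
  renaming (refl to ≈-refl; sym to ≈-sym; trans to ≈-trans; reflexive to ≈-reflexive)
open import Relation.Binary.Reasoning.Setoid (CommutativeRing.setoid seriesCommutativeRing)

cst : ℤ → Series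
cst z zero    = z
cst z (suc _) = 0ℤ

cst-* : ∀ a b → cst (a * b) ≈ cst a ⊛ cst b
cst-* a b = coeffwise λ
  { zero    → sym (CauchyProduct.coefficient-zero (cst a) (cst b))
  ; (suc e) → sym (trans (CauchyProduct.coefficient-suc (cst a) (cst b) e)
                         (cong₂ _+_ (ℤP.*-zeroʳ a) (CauchyProduct.zeroˡ (cst b) e))) }

cst-homomorphism :
  CommutativeRing.rawRing ℤP.+-*-commutativeRing ACR.-Raw-AlmostCommutative⟶ ACR.fromCommutativeRing seriesCommutativeRing
cst-homomorphism = record
  { ⟦_⟧ = cst
  ; +-homo = λ a b → coeffwise λ { zero → refl ; (suc e) → refl }
  ; *-homo = cst-*
  ; -‿homo = λ a → coeffwise λ { zero → refl ; (suc e) → refl }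
  ; 0-homo = coeffwise λ { zero → refl ; (suc e) → refl }
  ; 1-homo = coeffwise λ { zero → refl ; (suc e) → refl } }

cst-≟ : ∀ a b → Maybe (cst a ≈ cst b)
cst-≟ a b with a ℤ.≟ b
... | yes refl = just ≈-refl
... | no _     = nothing

open import Algebra.Solver.Ring _ _ cst-homomorphism cst-≟ using (solve; _:=_; _:+_; _:*_; _:-_; con)

⊛-zeroʳ-cong : ∀ a {X} → X ≈ zeroS → a ⊛ X ≈ zeroS
⊛-zeroʳ-cong a X≈0 = ≈-trans (*-congˡ {a} X≈0) (zeroʳ a)

⊖-zero-cong : ∀ {X Y} → X ≈ zeroS → Y ≈ zeroS → X ⊖ Y ≈ zeroS
⊖-zero-cong X≈0 Y≈0 = ≈-trans (+-cong X≈0 (-‿cong Y≈0)) (coeffwise λ _ → refl)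

shiftS : Series → Series
shiftS f zero    = 0ℤ
shiftS f (suc e) = f e

shiftS-cong : ∀ {f g} → f ≈ g → shiftS f ≈ shiftS g
shiftS-cong f≈g = coeffwise λ { zero → refl ; (suc e) → coeff f≈g e }

shiftS-⊛ : ∀ f g → shiftS f ⊛ g ≈ shiftS (f ⊛ g)
shiftS-⊛ f g = coeffwise λ
  { zero    → CauchyProduct.coefficient-zero (shiftS f) g
  ; (suc e) → trans (CauchyProduct.coefficient-suc (shiftS f) g e) (ℤP.+-identityˡ ((f ⊛ g) e)) }

mono-zero : mono 0 ≈ oneS
mono-zero = coeffwise λ { zero → refl ; (suc e) → refl }

mono-suc : ∀ d → mono (suc d) ≈ shiftS (mono d)
mono-suc d = coeffwise λ { zero → refl ; (suc e) → refl }

mono-suc-⊛ : ∀ d f → mono (suc d) ⊛ f ≈ shiftS (mono d ⊛ f)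
mono-suc-⊛ d f = ≈-trans (*-congʳ {f} (mono-suc d)) (shiftS-⊛ (mono d) f)

mono-+ : ∀ a b → mono a ⊛ mono b ≈ mono (a ℕ.+ b)
mono-+ zero    b = ≈-trans (*-congʳ {mono b} mono-zero) (*-identityˡ (mono b))
mono-+ (suc a) b = begin
  mono (suc a) ⊛ mono b       ≈⟨ mono-suc-⊛ a (mono b) ⟩
  shiftS (mono a ⊛ mono b)    ≈⟨ shiftS-cong (mono-+ a b) ⟩
  shiftS (mono (a ℕ.+ b))     ≈⟨ mono-suc (a ℕ.+ b) ⟨
  mono (suc a ℕ.+ b) ∎

mono-⊛-coeff-+ : ∀ d f e → (mono d ⊛ f) (d ℕ.+ e) ≡ f e
mono-⊛-coeff-+ zero    f e = coeff (≈-trans (*-congʳ {f} mono-zero) (*-identityˡ f)) e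
mono-⊛-coeff-+ (suc d) f e = trans (coeff (mono-suc-⊛ d f) (suc d ℕ.+ e)) (mono-⊛-coeff-+ d f e)

mono-⊛-coeff-< : ∀ d f e → e ℕ.< d → (mono d ⊛ f) e ≡ 0ℤ
mono-⊛-coeff-< (suc d) f zero    _             = coeff (mono-suc-⊛ d f) zero
mono-⊛-coeff-< (suc d) f (suc e) (ℕ.s≤s e<d) = trans (coeff (mono-suc-⊛ d f) (suc e)) (mono-⊛-coeff-< d f e e<d)

mono-⊛-cancel : ∀ d {f g} → mono d ⊛ f ≈ mono d ⊛ g → f ≈ g
mono-⊛-cancel d {f} {g} eq = coeffwise λ e →
  trans (sym (mono-⊛-coeff-+ d f e)) (trans (coeff eq (d ℕ.+ e)) (mono-⊛-coeff-+ d g e))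

q^_ : ℕ → Series
q^ d = mono (2 ℕ.* d)

q^-+ : ∀ a b → q^ a ⊛ q^ b ≈ q^ (a ℕ.+ b)
q^-+ a b = ≈-trans (mono-+ (2 ℕ.* a) (2 ℕ.* b)) (≈-reflexive (cong mono (sym (ℕP.*-distribˡ-+ 2 a b))))

q^-cong : ∀ {a b} → a ≡ b → q^ a ≈ q^ b
q^-cong refl = ≈-refl

q^-+₃ : ∀ a b c → q^ a ⊛ q^ b ⊛ q^ c ≈ q^ (a ℕ.+ b ℕ.+ c)
q^-+₃ a b c = ≈-trans (*-congʳ {q^ c} (q^-+ a b)) (q^-+ (a ℕ.+ b) c)

q^-+₄ : ∀ a b c d → q^ a ⊛ q^ b ⊛ q^ c ⊛ q^ d ≈ q^ (a ℕ.+ b ℕ.+ c ℕ.+ d)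
q^-+₄ a b c d = ≈-trans (*-congʳ {q^ d} (q^-+₃ a b c)) (q^-+ (a ℕ.+ b ℕ.+ c) d)

oneMinusQ≈1⊖q^ : ∀ d → oneMinusQ d ≈ cst 1ℤ ⊖ q^ d
oneMinusQ≈1⊖q^ d = coeffwise λ { zero → refl ; (suc e) → refl }

geomQ-periodic : ∀ k e → geomQ k (2 ℕ.* suc k ℕ.+ e) ≡ geomQ k e
geomQ-periodic k e = cong (λ r → if r ≡ᵇ 0 then 1ℤ else 0ℤ)
  (trans (cong (ℕ._% d) (ℕP.+-comm d e)) (ℕD.[m+n]%n≡m%n e d))
  where d = 2 ℕ.* suc k

geomQ-< : ∀ k e → e ℕ.< 2 ℕ.* suc k → geomQ k e ≡ oneS e
geomQ-< k e e<d rewrite ℕD.m<n⇒m%n≡m e<d with e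
... | zero  = refl
... | suc _ = refl

oneMinusQ-⊛-geomQ : ∀ k → oneMinusQ (suc k) ⊛ geomQ k ≈ oneS
oneMinusQ-⊛-geomQ k = begin
  oneMinusQ (suc k) ⊛ geomQ k
    ≈⟨ *-congʳ {geomQ k} (oneMinusQ≈1⊖q^ (suc k)) ⟩
  (cst 1ℤ ⊖ mono d) ⊛ geomQ k
    ≈⟨ solve 2 (λ m γ → (con 1ℤ :- m) :* γ := γ :- m :* γ) ≈-refl (mono d) (geomQ k) ⟩
  geomQ k ⊖ mono d ⊛ geomQ k
    ≈⟨ coeffwise coefficient ⟩
  oneS ∎
  where
  d = 2 ℕ.* suc k
  coefficient : ∀ e → geomQ k e - (mono d ⊛ geomQ k) e ≡ oneS e
  coefficient e with e ℕP.<? d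
  ... | yes e<d = trans (cong (λ x → geomQ k e - x) (mono-⊛-coeff-< d (geomQ k) e e<d))
                        (trans (ℤP.+-identityʳ (geomQ k e)) (geomQ-< k e e<d))
  ... | no e≮d  = subst (λ x → geomQ k x - (mono d ⊛ geomQ k) x ≡ oneS x)
                        (ℕP.m+[n∸m]≡n (ℕP.≮⇒≥ e≮d)) (beyond-period (e ∸ d))
    where
    beyond-period : ∀ e → geomQ k (d ℕ.+ e) - (mono d ⊛ geomQ k) (d ℕ.+ e) ≡ 0ℤ
    beyond-period e = trans (cong₂ _-_ (geomQ-periodic k e) (mono-⊛-coeff-+ d (geomQ k) e)) (ℤP.+-inverseʳ (geomQ k e))

module ⊛Π = CommutativeMonoidSum (CommutativeRing.*-commutativeMonoid seriesCommutativeRing)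

∏ : ∀ n → (ℕ → Series) → Series
∏ n f = ⊛Π.sum {n} (f ∘ toℕ)

∏-snoc : ∀ n f → ∏ (suc n) f ≈ ∏ n f ⊛ f n
∏-snoc n f = ≈-trans (⊛Π.sum-init-last {n} (f ∘ toℕ))
  (*-cong (≈-reflexive (⊛Π.sum-cong-≗ {n} (λ i → cong f (toℕ-inject₁ i)))) (≈-reflexive (cong f (toℕ-fromℕ n))))

∏-⊛ : ∀ n f g → ∏ n (λ i → f i ⊛ g i) ≈ ∏ n f ⊛ ∏ n g
∏-⊛ n f g = ⊛Π.∑-distrib-+ {n} (f ∘ toℕ) (g ∘ toℕ)

∏-oneS : ∀ n f → (∀ i → f i ≈ oneS) → ∏ n f ≈ oneS
∏-oneS n f f≈1 = ≈-trans (⊛Π.sum-cong-≋ {n} (f≈1 ∘ toℕ)) (⊛Π.sum-replicate-zero n)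

module ⊕Σ where
  open CommutativeMonoidSum (CommutativeRing.+-commutativeMonoid seriesCommutativeRing) public
  open SemiringSum (CommutativeRing.semiring seriesCommutativeRing) public using (*-distribˡ-sum)

∑ : ℕ → (ℕ → Series) → Series
∑ n f = ⊕Σ.sum {n} (f ∘ toℕ)

∑-cong : ∀ n {f g} → (∀ i → f i ≈ g i) → ∑ n f ≈ ∑ n g
∑-cong n f≈g = ⊕Σ.sum-cong-≋ {n} (f≈g ∘ toℕ)

∑-zero : ∀ n (f : ℕ → Series) → (∀ i → i ℕ.< n → f i ≈ zeroS) → ∑ n f ≈ zeroS
∑-zero n f f≈0 = ≈-trans (⊕Σ.sum-cong-≋ {n} (λ i → f≈0 (toℕ i) (toℕ<n i))) (⊕Σ.sum-replicate-zero n)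

∑-⊖ : ∀ n (f g : ℕ → Series) → ∑ n f ⊖ ∑ n g ≈ ∑ n (λ i → f i ⊖ g i)
∑-⊖ zero    f g = coeffwise λ _ → refl
∑-⊖ (suc n) f g = ≈-trans
  (solve 4 (λ a b c d → (a :+ b) :- (c :+ d) := (a :- c) :+ (b :- d)) ≈-refl (f 0) (∑ n (f ∘ suc)) (g 0) (∑ n (g ∘ suc)))
  (+-congˡ {f 0 ⊖ g 0} (∑-⊖ n (f ∘ suc) (g ∘ suc)))

∑-telescope : ∀ n (Φ : ℕ → Series) → ∑ n (λ i → Φ i ⊖ Φ (suc i)) ≈ Φ 0 ⊖ Φ n
∑-telescope zero    Φ = coeffwise λ e → sym (ℤP.+-inverseʳ (Φ 0 e))
∑-telescope (suc n) Φ = ≈-trans (+-congˡ {Φ 0 ⊖ Φ 1} (∑-telescope n (Φ ∘ suc)))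
  (solve 3 (λ a b c → (a :- b) :+ (b :- c) := a :- c) ≈-refl (Φ 0) (Φ 1) (Φ (suc n)))

gaussNat-∏ : ∀ m n → gaussNat m n ≡ ∏ m (λ k → oneMinusQ (n ℕ.+ suc k)) ⊛ ∏ m geomQ
gaussNat-∏ m n = cong₂ _⊛_ (foldr-map-applyUpTo _⊛_ oneS (λ k → oneMinusQ (n ℕ.+ suc k)) (λ k → k) m)
                           (foldr-map-applyUpTo _⊛_ oneS geomQ (λ k → k) m)

gaussNat-zeroˡ : ∀ n → gaussNat 0 n ≈ oneS
gaussNat-zeroˡ n = *-identityˡ oneS

gaussNat-zeroʳ : ∀ m → gaussNat m 0 ≈ oneS
gaussNat-zeroʳ m = begin
  gaussNat m 0                                                ≡⟨ gaussNat-∏ m 0 ⟩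
  ∏ m (λ k → oneMinusQ (suc k)) ⊛ ∏ m geomQ                   ≈⟨ ∏-⊛ m (λ k → oneMinusQ (suc k)) geomQ ⟨
  ∏ m (λ k → oneMinusQ (suc k) ⊛ geomQ k)                      ≈⟨ ∏-oneS m _ oneMinusQ-⊛-geomQ ⟩
  oneS ∎

-- The numerator factor splits as 1 − q^(n+m+2) = (1 − q^(n+1)) + q^(n+1) (1 − q^(m+1)),
-- and the second summand is cancelled by the last factor 1/(1 − q^(m+1)) of the denominator.
gaussNat-pascal : ∀ m n → gaussNat (suc m) (suc n) ≈ gaussNat (suc m) n ⊕ q^ (suc n) ⊛ gaussNat m (suc n)
gaussNat-pascal m n = begin
  gaussNat (suc m) (suc n)
    ≡⟨ gaussNat-∏ (suc m) (suc n) ⟩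
  ∏ (suc m) (λ k → oneMinusQ (suc n ℕ.+ suc k)) ⊛ ∏ (suc m) geomQ
    ≈⟨ *-cong (∏-snoc m (λ k → oneMinusQ (suc n ℕ.+ suc k))) (∏-snoc m geomQ) ⟩
  X ⊛ oneMinusQ (suc n ℕ.+ suc m) ⊛ (D ⊛ γ)
    ≈⟨ *-congʳ {D ⊛ γ} (*-congˡ {X} (≈-trans (oneMinusQ≈1⊖q^ (suc n ℕ.+ suc m))
                                              (+-congˡ {cst 1ℤ} (-‿cong (≈-sym (q^-+ (suc n) (suc m))))))) ⟩
  X ⊛ (cst 1ℤ ⊖ b ⊛ a) ⊛ (D ⊛ γ)
    ≈⟨ solve 5 (λ X D γ a b → X :* (con 1ℤ :- b :* a) :* (D :* γ)
                              := (con 1ℤ :- b) :* X :* (D :* γ) :+ b :* (X :* D) :* ((con 1ℤ :- a) :* γ))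
             ≈-refl X D γ a b ⟩
  (cst 1ℤ ⊖ b) ⊛ X ⊛ (D ⊛ γ) ⊕ b ⊛ (X ⊛ D) ⊛ ((cst 1ℤ ⊖ a) ⊛ γ)
    ≈⟨ +-cong (*-cong numerator (≈-sym (∏-snoc m geomQ)))
              (*-congˡ {b ⊛ (X ⊛ D)} (≈-trans (*-congʳ {γ} (≈-sym (oneMinusQ≈1⊖q^ (suc m)))) (oneMinusQ-⊛-geomQ m))) ⟩
  ∏ (suc m) (λ k → oneMinusQ (n ℕ.+ suc k)) ⊛ ∏ (suc m) geomQ ⊕ b ⊛ (X ⊛ D) ⊛ oneS
    ≈⟨ +-cong (≈-reflexive (sym (gaussNat-∏ (suc m) n)))
              (≈-trans (*-identityʳ (b ⊛ (X ⊛ D))) (*-congˡ {b} (≈-reflexive (sym (gaussNat-∏ m (suc n)))))) ⟩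
  gaussNat (suc m) n ⊕ q^ (suc n) ⊛ gaussNat m (suc n) ∎
  where
  X = ∏ m (λ k → oneMinusQ (suc n ℕ.+ suc k))
  D = ∏ m geomQ
  γ = geomQ m
  a = q^ (suc m)
  b = q^ (suc n)
  numerator : (cst 1ℤ ⊖ b) ⊛ X ≈ ∏ (suc m) (λ k → oneMinusQ (n ℕ.+ suc k))
  numerator = *-cong (≈-trans (≈-sym (oneMinusQ≈1⊖q^ (suc n))) (≈-reflexive (cong oneMinusQ (sym (ℕP.+-comm n 1)))))
                     (⊛Π.sum-cong-≋ {m} λ k → ≈-reflexive (cong oneMinusQ (sym (ℕP.+-suc n (suc (toℕ k))))))

gauss-by-difference : ∀ A m n → A - + m ≡ + n → gauss A (+ m) ≡ gaussNat m n
gauss-by-difference A m n A-m≡n rewrite A-m≡n = refl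

gauss-by-negative-difference : ∀ A m k → A - + m ≡ -[1+ k ] → gauss A (+ m) ≡ zeroS
gauss-by-negative-difference A m k A-m≡-1-k rewrite A-m≡-1-k = refl

gauss-nonneg : ∀ {A} m n → A ≡ + (m ℕ.+ n) → gauss A (+ m) ≈ gaussNat m n
gauss-nonneg m n refl = ≈-reflexive (gauss-by-difference (+ (m ℕ.+ n)) m n
  (trans (ℤP.m-n≡m⊖n (m ℕ.+ n) m) (trans (ℤP.⊖-≥ (ℕP.m≤m+n m n)) (cong +_ (ℕP.m+n∸m≡n m n)))))

m⊖1+n≡-[1+n∸m] : ∀ {m n} → m ℕ.≤ n → m ℤ.⊖ suc n ≡ -[1+ n ∸ m ]
m⊖1+n≡-[1+n∸m] m≤n = trans (ℤP.⊖-< (ℕ.s≤s m≤n)) (cong (λ x → - + x) (ℕP.+-∸-assoc 1 m≤n))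

gauss-lower>upper : ∀ {a b} → a ℕ.< b → gauss (+ a) (+ b) ≈ zeroS
gauss-lower>upper {a} {suc b} (ℕ.s≤s a≤b) = ≈-reflexive
  (gauss-by-negative-difference (+ a) (suc b) (b ∸ a) (trans (ℤP.m-n≡m⊖n a (suc b)) (m⊖1+n≡-[1+n∸m] a≤b)))

gauss-zero-index : ∀ n → gauss (+ n) (+ 0) ≈ oneS
gauss-zero-index n = ≈-trans (gauss-nonneg 0 n refl) (gaussNat-zeroˡ n)

gauss-diagonal : ∀ m → gauss (+ m) (+ m) ≈ oneS
gauss-diagonal m = ≈-trans (gauss-nonneg m 0 (cong +_ (sym (ℕP.+-identityʳ m)))) (gaussNat-zeroʳ m)

-- Pascal's rule [P+1; v] = [P; v] + q^(P+1−v) [P; v−1], multiplied by q^v so that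
-- no exponent involves a subtraction.
QPascal : ℕ → ℕ → Set
QPascal P v = q^ v ⊛ gauss (+ suc P) (+ v) ≈ q^ v ⊛ gauss (+ P) (+ v) ⊕ q^ (suc P) ⊛ gauss (+ P) (+ v - 1ℤ)

qPascal-zero : ∀ P → QPascal P 0
qPascal-zero P = begin
  q^ 0 ⊛ gauss (+ suc P) (+ 0)
    ≈⟨ *-congˡ {q^ 0} (≈-trans (gauss-zero-index (suc P)) (≈-sym (gauss-zero-index P))) ⟩
  q^ 0 ⊛ gauss (+ P) (+ 0)
    ≈⟨ +-identityʳ (q^ 0 ⊛ gauss (+ P) (+ 0)) ⟨
  q^ 0 ⊛ gauss (+ P) (+ 0) ⊕ zeroS
    ≈⟨ +-congˡ {q^ 0 ⊛ gauss (+ P) (+ 0)} (zeroʳ (q^ (suc P))) ⟨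
  q^ 0 ⊛ gauss (+ P) (+ 0) ⊕ q^ (suc P) ⊛ gauss (+ P) (+ 0 - 1ℤ) ∎

qPascal-interior : ∀ v n → QPascal (v ℕ.+ suc n) (suc v)
qPascal-interior v n = begin
  q^ (suc v) ⊛ gauss (+ suc P) (+ suc v)
    ≈⟨ *-congˡ {q^ (suc v)} (≈-trans (gauss-nonneg (suc v) (suc n) refl) (gaussNat-pascal v n)) ⟩
  q^ (suc v) ⊛ (gaussNat (suc v) n ⊕ q^ (suc n) ⊛ gaussNat v (suc n))
    ≈⟨ solve 4 (λ a b c d → a :* (b :+ c :* d) := a :* b :+ (a :* c) :* d)
             ≈-refl (q^ (suc v)) (gaussNat (suc v) n) (q^ (suc n)) (gaussNat v (suc n)) ⟩
  q^ (suc v) ⊛ gaussNat (suc v) n ⊕ q^ (suc v) ⊛ q^ (suc n) ⊛ gaussNat v (suc n)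
    ≈⟨ +-cong (*-congˡ {q^ (suc v)} (≈-sym (gauss-nonneg (suc v) n (cong +_ (ℕP.+-suc v n)))))
              (*-cong (q^-+ (suc v) (suc n)) (≈-sym (gauss-nonneg v (suc n) refl))) ⟩
  q^ (suc v) ⊛ gauss (+ P) (+ suc v) ⊕ q^ (suc P) ⊛ gauss (+ P) (+ suc v - 1ℤ) ∎
  where P = v ℕ.+ suc n

qPascal-diagonal : ∀ v → QPascal v (suc v)
qPascal-diagonal v = begin
  q^ (suc v) ⊛ gauss (+ suc v) (+ suc v)
    ≈⟨ *-congˡ {q^ (suc v)} (≈-trans (gauss-diagonal (suc v)) (≈-sym (gauss-diagonal v))) ⟩
  q^ (suc v) ⊛ gauss (+ v) (+ v)
    ≈⟨ +-identityˡ (q^ (suc v) ⊛ gauss (+ v) (+ v)) ⟨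
  zeroS ⊕ q^ (suc v) ⊛ gauss (+ v) (+ v)
    ≈⟨ +-congʳ {q^ (suc v) ⊛ gauss (+ v) (+ v)} (⊛-zeroʳ-cong (q^ (suc v)) (gauss-lower>upper (ℕP.n<1+n v))) ⟨
  q^ (suc v) ⊛ gauss (+ v) (+ suc v) ⊕ q^ (suc v) ⊛ gauss (+ v) (+ suc v - 1ℤ) ∎

qPascal-beyond : ∀ P v → P ℕ.< v → QPascal P (suc v)
qPascal-beyond P v P<v = begin
  q^ (suc v) ⊛ gauss (+ suc P) (+ suc v)
    ≈⟨ ⊛-zeroʳ-cong (q^ (suc v)) (gauss-lower>upper (ℕ.s≤s P<v)) ⟩
  zeroS
    ≈⟨ ⊖-zero-cong {zeroS} {zeroS} ≈-refl ≈-refl ⟨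
  zeroS ⊕ zeroS
    ≈⟨ +-cong (⊛-zeroʳ-cong (q^ (suc v)) (gauss-lower>upper (ℕP.m<n⇒m<1+n P<v)))
              (⊛-zeroʳ-cong (q^ (suc P)) (gauss-lower>upper P<v)) ⟨
  q^ (suc v) ⊛ gauss (+ P) (+ suc v) ⊕ q^ (suc P) ⊛ gauss (+ P) (+ suc v - 1ℤ) ∎

qPascal : ∀ P v → QPascal P v
qPascal P zero = qPascal-zero P
qPascal P (suc v) with ℕP.<-cmp v P
... | tri< v<P _ _ = subst (λ P → QPascal P (suc v)) (trans (ℕP.+-suc v (P ∸ suc v)) (ℕP.m+[n∸m]≡n v<P))
                           (qPascal-interior v (P ∸ suc v))
... | tri≈ _ refl _ = qPascal-diagonal v
... | tri> _ _ P<v  = qPascal-beyond P v P<v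

-- Expanding q^u x and q^v z by Pascal's rule, the two products x' · q^v y cancel.
pascal-products : ∀ (x x' x'' y z y' : Series) P u v →
  q^ u ⊛ x ≈ q^ u ⊛ x' ⊕ q^ P ⊛ x'' →
  q^ v ⊛ z ≈ q^ v ⊛ y ⊕ q^ (suc P) ⊛ y' →
  q^ u ⊛ q^ v ⊛ (x ⊛ y ⊖ x' ⊛ z) ≈ q^ P ⊛ q^ v ⊛ (x'' ⊛ y) ⊖ q^ u ⊛ q^ (suc P) ⊛ (x' ⊛ y')
pascal-products x x' x'' y z y' P u v pascal-x pascal-z = begin
  q^ u ⊛ q^ v ⊛ (x ⊛ y ⊖ x' ⊛ z)
    ≈⟨ solve 6 (λ a b x y x' z → a :* b :* (x :* y :- x' :* z) := (a :* x) :* (b :* y) :- (a :* x') :* (b :* z))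
             ≈-refl (q^ u) (q^ v) x y x' z ⟩
  (q^ u ⊛ x) ⊛ (q^ v ⊛ y) ⊖ (q^ u ⊛ x') ⊛ (q^ v ⊛ z)
    ≈⟨ +-cong (*-congʳ {q^ v ⊛ y} pascal-x) (-‿cong (*-congˡ {q^ u ⊛ x'} pascal-z)) ⟩
  (q^ u ⊛ x' ⊕ q^ P ⊛ x'') ⊛ (q^ v ⊛ y) ⊖ (q^ u ⊛ x') ⊛ (q^ v ⊛ y ⊕ q^ (suc P) ⊛ y')
    ≈⟨ solve 8 (λ a b c d x' x'' y y' → (a :* x' :+ c :* x'') :* (b :* y) :- (a :* x') :* (b :* y :+ d :* y')
                                        := c :* b :* (x'' :* y) :- a :* d :* (x' :* y'))
             ≈-refl (q^ u) (q^ v) (q^ P) (q^ (suc P)) x' x'' y y' ⟩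
  q^ P ⊛ q^ v ⊛ (x'' ⊛ y) ⊖ q^ u ⊛ q^ (suc P) ⊛ (x' ⊛ y') ∎

pascal-products-rescaled : ∀ (x x' x'' y z y' : Series) P u v K e₀ e₁ e₂ →
  q^ u ⊛ x ≈ q^ u ⊛ x' ⊕ q^ P ⊛ x'' →
  q^ v ⊛ z ≈ q^ v ⊛ y ⊕ q^ (suc P) ⊛ y' →
  P ℕ.+ v ℕ.+ e₀ ≡ K ℕ.+ u ℕ.+ v ℕ.+ e₁ →
  u ℕ.+ suc P ℕ.+ e₀ ≡ K ℕ.+ u ℕ.+ v ℕ.+ e₂ →
  q^ e₀ ⊛ (x ⊛ y ⊖ x' ⊛ z) ≈ q^ K ⊛ (q^ e₁ ⊛ (x'' ⊛ y) ⊖ q^ e₂ ⊛ (x' ⊛ y'))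
pascal-products-rescaled x x' x'' y z y' P u v K e₀ e₁ e₂ pascal-x pascal-z exp₁ exp₂ =
  mono-⊛-cancel (2 ℕ.* (u ℕ.+ v)) (begin
    q^ (u ℕ.+ v) ⊛ (q^ e₀ ⊛ (x ⊛ y ⊖ x' ⊛ z))
      ≈⟨ *-congʳ {q^ e₀ ⊛ (x ⊛ y ⊖ x' ⊛ z)} (q^-+ u v) ⟨
    q^ u ⊛ q^ v ⊛ (q^ e₀ ⊛ (x ⊛ y ⊖ x' ⊛ z))
      ≈⟨ solve 4 (λ a b c d → a :* b :* (c :* d) := c :* (a :* b :* d))
               ≈-refl (q^ u) (q^ v) (q^ e₀) (x ⊛ y ⊖ x' ⊛ z) ⟩
    q^ e₀ ⊛ (q^ u ⊛ q^ v ⊛ (x ⊛ y ⊖ x' ⊛ z))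
      ≈⟨ *-congˡ {q^ e₀} (pascal-products x x' x'' y z y' P u v pascal-x pascal-z) ⟩
    q^ e₀ ⊛ (q^ P ⊛ q^ v ⊛ A ⊖ q^ u ⊛ q^ (suc P) ⊛ B)
      ≈⟨ solve 7 (λ a b c d e A B → e :* (c :* b :* A :- a :* d :* B) := c :* b :* e :* A :- a :* d :* e :* B)
               ≈-refl (q^ u) (q^ v) (q^ P) (q^ (suc P)) (q^ e₀) A B ⟩
    q^ P ⊛ q^ v ⊛ q^ e₀ ⊛ A ⊖ q^ u ⊛ q^ (suc P) ⊛ q^ e₀ ⊛ B
      ≈⟨ +-cong (*-congʳ {A} (≈-trans (q^-+₃ P v e₀) (q^-cong exp₁)))
                (-‿cong (*-congʳ {B} (≈-trans (q^-+₃ u (suc P) e₀) (q^-cong exp₂)))) ⟩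
    q^ (K ℕ.+ u ℕ.+ v ℕ.+ e₁) ⊛ A ⊖ q^ (K ℕ.+ u ℕ.+ v ℕ.+ e₂) ⊛ B
      ≈⟨ +-cong (*-congʳ {A} (q^-+₄ K u v e₁)) (-‿cong (*-congʳ {B} (q^-+₄ K u v e₂))) ⟨
    q^ K ⊛ q^ u ⊛ q^ v ⊛ q^ e₁ ⊛ A ⊖ q^ K ⊛ q^ u ⊛ q^ v ⊛ q^ e₂ ⊛ B
      ≈⟨ solve 7 (λ k a b c d A B → k :* a :* b :* c :* A :- k :* a :* b :* d :* B := a :* b :* (k :* (c :* A :- d :* B)))
               ≈-refl (q^ K) (q^ u) (q^ v) (q^ e₁) (q^ e₂) A B ⟩
    q^ u ⊛ q^ v ⊛ (q^ K ⊛ (q^ e₁ ⊛ A ⊖ q^ e₂ ⊛ B))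
      ≈⟨ *-congʳ {q^ K ⊛ (q^ e₁ ⊛ A ⊖ q^ e₂ ⊛ B)} (q^-+ u v) ⟩
    q^ (u ℕ.+ v) ⊛ (q^ K ⊛ (q^ e₁ ⊛ A ⊖ q^ e₂ ⊛ B))
      ∎)
  where
  A = x'' ⊛ y
  B = x' ⊛ y'

pairDiff : ℕ → ℤ → ℤ → Series
pairDiff P U V = gauss (+ P) U ⊛ gauss (+ P) V ⊖ gauss (+ P - 1ℤ) U ⊛ gauss (+ suc P) V

boundaryCore : ℕ → ℤ → ℤ → Series
boundaryCore p U V = gauss (+ p) U ⊛ gauss (+ suc p) V

-- Once a lower index is negative both sides vanish, so the exponent hypotheses are only
-- needed when U and V are natural numbers.
pairDiff-telescopes : ∀ p U V K e₀ e₁ e₂ →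
  + suc p + V + + e₀ ≡ + K + U + V + + e₁ →
  U + + suc (suc p) + + e₀ ≡ + K + U + V + + e₂ →
  q^ e₀ ⊛ pairDiff (suc p) U V ≈ q^ K ⊛ (q^ e₁ ⊛ boundaryCore p (U - 1ℤ) V ⊖ q^ e₂ ⊛ boundaryCore p U (V - 1ℤ))
pairDiff-telescopes p (+ u) (+ v) K e₀ e₁ e₂ exp₁ exp₂ =
  pascal-products-rescaled
    (gauss (+ suc p) (+ u)) (gauss (+ p) (+ u)) (gauss (+ p) (+ u - 1ℤ))
    (gauss (+ suc p) (+ v)) (gauss (+ suc (suc p)) (+ v)) (gauss (+ suc p) (+ v - 1ℤ))
    (suc p) u v K e₀ e₁ e₂ (qPascal p u) (qPascal (suc p) v) (ℤP.+-injective exp₁) (ℤP.+-injective exp₂)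
pairDiff-telescopes p -[1+ k ] V K e₀ e₁ e₂ _ _ = ≈-trans
  (⊛-zeroʳ-cong (q^ e₀) (⊖-zero-cong (zeroˡ (gauss (+ suc p) V)) (zeroˡ (gauss (+ suc (suc p)) V))))
  (≈-sym (⊛-zeroʳ-cong (q^ K) (⊖-zero-cong (⊛-zeroʳ-cong (q^ e₁) (zeroˡ (gauss (+ suc p) V)))
                                            (⊛-zeroʳ-cong (q^ e₂) (zeroˡ (gauss (+ suc p) (V - 1ℤ)))))))
pairDiff-telescopes p (+ u) -[1+ k ] K e₀ e₁ e₂ _ _ = ≈-trans
  (⊛-zeroʳ-cong (q^ e₀) (⊖-zero-cong (zeroʳ (gauss (+ suc p) (+ u))) (zeroʳ (gauss (+ p) (+ u)))))
  (≈-sym (⊛-zeroʳ-cong (q^ K) (⊖-zero-cong (⊛-zeroʳ-cong (q^ e₁) (zeroʳ (gauss (+ p) (+ u - 1ℤ))))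
                                            (⊛-zeroʳ-cong (q^ e₂) (zeroʳ (gauss (+ p) (+ u)))))))

+∣i*i∣≡i*i : ∀ i → + ∣ i * i ∣ ≡ i * i
+∣i*i∣≡i*i i = trans (cong +_ (ℤP.abs-* i i))
  (sym (trans (cong (ℤ._◃ (∣ i ∣ ℕ.* ∣ i ∣)) (SignP.s*s≡+ (ℤ.sign i))) (ℤP.+◃n≡+n (∣ i ∣ ℕ.* ∣ i ∣))))

+∣i*[i+1]∣≡i*[i+1] : ∀ i → + ∣ i * (i + 1ℤ) ∣ ≡ i * (i + 1ℤ)
+∣i*[i+1]∣≡i*[i+1] (+ a)        =
  trans (cong +_ (ℤP.abs-◃ Sign.+ (a ℕ.* (a ℕ.+ 1)))) (sym (ℤP.+◃n≡+n (a ℕ.* (a ℕ.+ 1))))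
+∣i*[i+1]∣≡i*[i+1] -[1+ zero ]  = refl
+∣i*[i+1]∣≡i*[i+1] -[1+ suc a ] =
  trans (cong +_ (ℤP.abs-◃ Sign.+ (suc (suc a) ℕ.* suc a))) (sym (ℤP.+◃n≡+n (suc (suc a) ℕ.* suc a)))

-- q^(j(j+1)) ([P; M+j][P; M−j] − [P−1; M+j][P+1; M−j]); as j(j+1) ≥ 0, taking ∣_∣ loses nothing.
jTerm : ℕ → ℕ → ℤ → Series
jTerm P M j = q^ ∣ j * (j + 1ℤ) ∣ ⊛ pairDiff P (+ M + j) (+ M - j)

boundaryTerm : ℕ → ℕ → ℤ → Series
boundaryTerm p M j = q^ ∣ (j + 1ℤ) * (j + 1ℤ) ∣ ⊛ boundaryCore p (+ M + j) (+ M - j - 1ℤ)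

jTerm-telescopes : ∀ p M K j → suc p ≡ M ℕ.+ K →
  jTerm (suc p) M j ≈ q^ K ⊛ (boundaryTerm p M (j - 1ℤ) ⊖ boundaryTerm p M j)
jTerm-telescopes p M K j p+1≡M+K = ≈-trans
  (pairDiff-telescopes p (+ M + j) (+ M - j) K e₀ e₁ e₂ exponent₁ exponent₂)
  (*-congˡ {q^ K} (+-congʳ {⊝ boundaryTerm p M j} (*-congˡ {q^ e₁} (≈-reflexive
    (cong₂ (boundaryCore p) (shift-down (+ M) j) (sym (shift-down′ (+ M) j)))))))
  where
  e₀ = ∣ j * (j + 1ℤ) ∣
  e₁ = ∣ (j - 1ℤ + 1ℤ) * (j - 1ℤ + 1ℤ) ∣
  e₂ = ∣ (j + 1ℤ) * (j + 1ℤ) ∣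
  shift-down : ∀ M j → M + j - 1ℤ ≡ M + (j - 1ℤ)
  shift-down = solve-∀
  shift-down′ : ∀ M j → M - (j - 1ℤ) - 1ℤ ≡ M - j
  shift-down′ = solve-∀
  identity₁ : ∀ M K j → (M + K) + (M - j) + j * (j + 1ℤ) ≡ K + (M + j) + (M - j) + (j - 1ℤ + 1ℤ) * (j - 1ℤ + 1ℤ)
  identity₁ = solve-∀
  identity₂ : ∀ M K j → (M + j) + (1ℤ + (M + K)) + j * (j + 1ℤ) ≡ K + (M + j) + (M - j) + (j + 1ℤ) * (j + 1ℤ)
  identity₂ = solve-∀
  exponent₁ : + suc p + (+ M - j) + + e₀ ≡ + K + (+ M + j) + (+ M - j) + + e₁
  exponent₁ = trans (cong₂ (λ a b → a + (+ M - j) + b) (cong +_ p+1≡M+K) (+∣i*[i+1]∣≡i*[i+1] j))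
             (trans (identity₁ (+ M) (+ K) j)
                    (cong (_+_ (+ K + (+ M + j) + (+ M - j))) (sym (+∣i*i∣≡i*i (j - 1ℤ + 1ℤ)))))
  exponent₂ : + M + j + + suc (suc p) + + e₀ ≡ + K + (+ M + j) + (+ M - j) + + e₂
  exponent₂ = trans (cong₂ (λ a b → + M + j + (1ℤ + a) + b) (cong +_ p+1≡M+K) (+∣i*[i+1]∣≡i*[i+1] j))
             (trans (identity₂ (+ M) (+ K) j)
                    (cong (_+_ (+ K + (+ M + j) + (+ M - j))) (sym (+∣i*i∣≡i*i (j + 1ℤ)))))

minusHeaviside : ℤ → Series
minusHeaviside (+ _)    = ⊝ oneS
minusHeaviside -[1+ _ ] = zeroS

jTerm-zero-telescopes : ∀ j → jTerm 0 0 j ≈ minusHeaviside (j - 1ℤ) ⊖ minusHeaviside j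
jTerm-zero-telescopes (+ zero) = begin
  q^ 0 ⊛ (gauss (+ 0) (+ 0) ⊛ gauss (+ 0) (+ 0) ⊖ zeroS ⊛ gauss (+ 1) (+ 0))
    ≈⟨ *-cong mono-zero (+-cong (*-cong (gauss-zero-index 0) (gauss-zero-index 0)) (-‿cong (zeroˡ (gauss (+ 1) (+ 0))))) ⟩
  oneS ⊛ (oneS ⊛ oneS ⊖ zeroS)
    ≈⟨ *-identityˡ (oneS ⊛ oneS ⊖ zeroS) ⟩
  oneS ⊛ oneS ⊖ zeroS
    ≈⟨ coeffwise (λ e → ℤP.+-identityʳ ((oneS ⊛ oneS) e)) ⟩
  oneS ⊛ oneS
    ≈⟨ *-identityˡ oneS ⟩
  oneS
    ≈⟨ coeffwise (λ e → sym (trans (ℤP.+-identityˡ (- - oneS e)) (ℤP.neg-involutive (oneS e)))) ⟩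
  zeroS ⊖ ⊝ oneS ∎
jTerm-zero-telescopes (+ suc a) = ≈-trans
  (⊛-zeroʳ-cong (q^ ∣ + suc a * (+ suc a + 1ℤ) ∣)
    (⊖-zero-cong (≈-trans (*-congʳ {gauss (+ 0) (+ 0 - + suc a)} (gauss-lower>upper {0} {suc a} (ℕ.s≤s ℕ.z≤n)))
                          (zeroˡ (gauss (+ 0) (+ 0 - + suc a))))
                 (zeroˡ (gauss (+ 1) (+ 0 - + suc a)))))
  (coeffwise λ e → sym (ℤP.+-inverseʳ (- oneS e)))
jTerm-zero-telescopes -[1+ a ] =
  ⊛-zeroʳ-cong (q^ ∣ -[1+ a ] * (-[1+ a ] + 1ℤ) ∣)
    (⊖-zero-cong (zeroˡ (gauss (+ 0) (+ 0 - -[1+ a ]))) (zeroˡ (gauss (+ 1) (+ 0 - -[1+ a ]))))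

partialSum≡∑ : ∀ (f : ℤ → Series) K₁ K₂ →
  partialSum f K₁ K₂ ≡ ∑ (suc (K₁ ℕ.+ K₂)) (λ i → f (+ i - + K₁))
partialSum≡∑ f K₁ K₂ =
  trans (cong sumS (sym (ListP.map-∘ {g = f} {f = λ i → + i - + K₁} (upTo (suc (K₁ ℕ.+ K₂))))))
  (foldr-map-applyUpTo addS zeroS (λ i → f (+ i - + K₁)) (λ i → i) (suc (K₁ ℕ.+ K₂)))

partialSum-cong : ∀ {f g} K₁ K₂ → (∀ j → f j ≈ g j) → partialSum f K₁ K₂ ≈ partialSum g K₁ K₂
partialSum-cong {f} {g} K₁ K₂ f≈g = begin
  partialSum f K₁ K₂
    ≡⟨ partialSum≡∑ f K₁ K₂ ⟩
  ∑ (suc (K₁ ℕ.+ K₂)) (λ i → f (+ i - + K₁))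
    ≈⟨ ∑-cong (suc (K₁ ℕ.+ K₂)) (λ i → f≈g (+ i - + K₁)) ⟩
  ∑ (suc (K₁ ℕ.+ K₂)) (λ i → g (+ i - + K₁))
    ≡⟨ partialSum≡∑ g K₁ K₂ ⟨
  partialSum g K₁ K₂ ∎

partialSum-zero : ∀ {f} K₁ K₂ → (∀ j → f j ≈ zeroS) → partialSum f K₁ K₂ ≈ zeroS
partialSum-zero K₁ K₂ f≈0 = ≈-trans (partialSum-cong K₁ K₂ f≈0)
  (≈-trans (≈-reflexive (partialSum≡∑ (λ _ → zeroS) K₁ K₂)) (⊕Σ.sum-replicate-zero (suc (K₁ ℕ.+ K₂))))

partialSum-⊛ : ∀ c (f : ℤ → Series) K₁ K₂ → partialSum (λ j → c ⊛ f j) K₁ K₂ ≈ c ⊛ partialSum f K₁ K₂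
partialSum-⊛ c f K₁ K₂ = begin
  partialSum (λ j → c ⊛ f j) K₁ K₂
    ≡⟨ partialSum≡∑ (λ j → c ⊛ f j) K₁ K₂ ⟩
  ∑ (suc (K₁ ℕ.+ K₂)) (λ i → c ⊛ f (+ i - + K₁))
    ≈⟨ ⊕Σ.*-distribˡ-sum {suc (K₁ ℕ.+ K₂)} c (λ i → f (+ toℕ i - + K₁)) ⟨
  c ⊛ ∑ (suc (K₁ ℕ.+ K₂)) (λ i → f (+ i - + K₁))
    ≡⟨ cong (c ⊛_) (partialSum≡∑ f K₁ K₂) ⟨
  c ⊛ partialSum f K₁ K₂ ∎

partialSum-∑ : ∀ n (f : ℕ → ℤ → Series) K₁ K₂ →
  partialSum (λ j → ∑ n (λ i → f i j)) K₁ K₂ ≈ ∑ n (λ i → partialSum (f i) K₁ K₂)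
partialSum-∑ n f K₁ K₂ = begin
  partialSum (λ j → ∑ n (λ i → f i j)) K₁ K₂
    ≡⟨ partialSum≡∑ (λ j → ∑ n (λ i → f i j)) K₁ K₂ ⟩
  ∑ (suc (K₁ ℕ.+ K₂)) (λ k → ∑ n (λ i → f i (+ k - + K₁)))
    ≈⟨ ⊕Σ.∑-comm {suc (K₁ ℕ.+ K₂)} {n} (λ k i → f (toℕ i) (+ toℕ k - + K₁)) ⟩
  ∑ n (λ i → ∑ (suc (K₁ ℕ.+ K₂)) (λ k → f i (+ k - + K₁)))
    ≈⟨ ∑-cong n (λ i → ≈-reflexive (sym (partialSum≡∑ (f i) K₁ K₂))) ⟩
  ∑ n (λ i → partialSum (f i) K₁ K₂) ∎

partialSum-telescopes : ∀ {f} (Φ : ℤ → Series) K₁ K₂ → (∀ j → f j ≈ Φ (j - 1ℤ) ⊖ Φ j) →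
  partialSum f K₁ K₂ ≈ Φ -[1+ K₁ ] ⊖ Φ (+ K₂)
partialSum-telescopes {f} Φ K₁ K₂ f≈ΔΦ = begin
  partialSum f K₁ K₂
    ≡⟨ partialSum≡∑ f K₁ K₂ ⟩
  ∑ (suc (K₁ ℕ.+ K₂)) (λ i → f (+ i - + K₁))
    ≈⟨ ∑-cong (suc (K₁ ℕ.+ K₂)) step ⟩
  ∑ (suc (K₁ ℕ.+ K₂)) (λ i → Φ′ i ⊖ Φ′ (suc i))
    ≈⟨ ∑-telescope (suc (K₁ ℕ.+ K₂)) Φ′ ⟩
  Φ′ 0 ⊖ Φ′ (suc (K₁ ℕ.+ K₂))
    ≡⟨ cong₂ (λ a b → Φ a ⊖ Φ b) (lower-end (+ K₁)) (upper-end (+ K₁) (+ K₂)) ⟩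
  Φ -[1+ K₁ ] ⊖ Φ (+ K₂) ∎
  where
  Φ′ : ℕ → Series
  Φ′ i = Φ (+ i - + K₁ - 1ℤ)
  next : ∀ i k → 1ℤ + i - k - 1ℤ ≡ i - k
  next = solve-∀
  step : ∀ i → f (+ i - + K₁) ≈ Φ′ i ⊖ Φ′ (suc i)
  step i = ≈-trans (f≈ΔΦ (+ i - + K₁)) (+-congˡ {Φ′ i} (-‿cong (≈-reflexive (cong Φ (sym (next (+ i) (+ K₁)))))))
  lower-end : ∀ k → 0ℤ - k - 1ℤ ≡ - (1ℤ + k)
  lower-end = solve-∀
  upper-end : ∀ a b → 1ℤ + (a + b) - a - 1ℤ ≡ b
  upper-end = solve-∀

boundaryTerm-below : ∀ p M K → M ℕ.≤ K → boundaryTerm p M -[1+ K ] ≈ zeroS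
boundaryTerm-below p M K M≤K = ⊛-zeroʳ-cong (q^ ∣ (-[1+ K ] + 1ℤ) * (-[1+ K ] + 1ℤ) ∣)
  (≈-trans (*-congʳ {gauss (+ suc p) (+ M - -[1+ K ] - 1ℤ)} (≈-reflexive (cong (gauss (+ p)) (m⊖1+n≡-[1+n∸m] M≤K))))
           (zeroˡ (gauss (+ suc p) (+ M - -[1+ K ] - 1ℤ))))

boundaryTerm-above : ∀ p M K → M ℕ.≤ K → boundaryTerm p M (+ K) ≈ zeroS
boundaryTerm-above p M K M≤K = ⊛-zeroʳ-cong (q^ ∣ (+ K + 1ℤ) * (+ K + 1ℤ) ∣)
  (≈-trans (*-congˡ {gauss (+ p) (+ M + + K)} (≈-reflexive (cong (gauss (+ suc p)) upper-index)))
           (zeroʳ (gauss (+ p) (+ M + + K))))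
  where
  regroup : ∀ m k → m - k - 1ℤ ≡ m - (1ℤ + k)
  regroup = solve-∀
  upper-index : + M - + K - 1ℤ ≡ -[1+ K ∸ M ]
  upper-index = trans (regroup (+ M) (+ K)) (m⊖1+n≡-[1+n∸m] M≤K)

partialSum-jTerm-vanishes : ∀ p M K K₁ K₂ → suc p ≡ M ℕ.+ K → M ℕ.≤ K₁ → M ℕ.≤ K₂ →
  partialSum (jTerm (suc p) M) K₁ K₂ ≈ zeroS
partialSum-jTerm-vanishes p M K K₁ K₂ p+1≡M+K M≤K₁ M≤K₂ = begin
  partialSum (jTerm (suc p) M) K₁ K₂   ≈⟨ partialSum-telescopes Φ K₁ K₂ jTerm≈ΔΦ ⟩
  Φ -[1+ K₁ ] ⊖ Φ (+ K₂)               ≈⟨ ⊖-zero-cong (⊛-zeroʳ-cong (q^ K) (boundaryTerm-below p M K₁ M≤K₁))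
                                                      (⊛-zeroʳ-cong (q^ K) (boundaryTerm-above p M K₂ M≤K₂)) ⟩
  zeroS ∎
  where
  Φ : ℤ → Series
  Φ j = q^ K ⊛ boundaryTerm p M j
  jTerm≈ΔΦ : ∀ j → jTerm (suc p) M j ≈ Φ (j - 1ℤ) ⊖ Φ j
  jTerm≈ΔΦ j = ≈-trans (jTerm-telescopes p M K j p+1≡M+K)
    (solve 3 (λ c a b → c :* (a :- b) := c :* a :- c :* b) ≈-refl (q^ K) (boundaryTerm p M (j - 1ℤ)) (boundaryTerm p M j))

partialSum-jTerm-zero : ∀ K₁ K₂ → partialSum (jTerm 0 0) K₁ K₂ ≈ oneS
partialSum-jTerm-zero K₁ K₂ = ≈-trans (partialSum-telescopes minusHeaviside K₁ K₂ jTerm-zero-telescopes)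
  (coeffwise λ e → trans (ℤP.+-identityˡ (- - oneS e)) (ℤP.neg-involutive (oneS e)))

double : ℕ → ℕ
double a = a ℕ.+ a

double≡*2 : ∀ a → double a ≡ a ℕ.* 2
double≡*2 a = trans (cong (a ℕ.+_) (sym (ℕP.+-identityʳ a))) (ℕP.*-comm 2 a)

isEven-double : ∀ w → isEven (w + w) ≡ true
isEven-double (+ a)    = trans (cong (λ x → x ℕ.% 2 ≡ᵇ 0) (double≡*2 a)) (cong (_≡ᵇ 0) (ℕD.m*n%n≡0 a 2))
isEven-double -[1+ a ] = trans (cong (λ x → suc (suc x) ℕ.% 2 ≡ᵇ 0) (double≡*2 a)) (cong (_≡ᵇ 0) (ℕD.m*n%n≡0 (suc a) 2))

isEven-1+double : ∀ w → isEven (1ℤ + (w + w)) ≡ false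
isEven-1+double (+ a)    = trans (cong (λ x → suc x ℕ.% 2 ≡ᵇ 0) (double≡*2 a)) (cong (_≡ᵇ 0) (ℕD.[m+kn]%n≡m%n 1 a 2))
isEven-1+double -[1+ a ] = trans (cong (λ x → suc x ℕ.% 2 ≡ᵇ 0) (double≡*2 a)) (cong (_≡ᵇ 0) (ℕD.[m+kn]%n≡m%n 1 a 2))

half-double : ∀ w → half (w + w) ≡ w
half-double (+ a)    = cong +_ (trans (cong (ℕ._/ 2) (double≡*2 a)) (ℕD.m*n/n≡m a 2))
half-double -[1+ a ] = cong (λ x → - + x) (trans (cong (λ x → suc (suc x) ℕ./ 2) (double≡*2 a)) (ℕD.m*n/n≡m (suc a) 2))

even-or-odd : ∀ d → Σ ℕ λ K → d ≡ double K ⊎ d ≡ suc (double K)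
even-or-odd zero = 0 , inj₁ refl
even-or-odd (suc d) with even-or-odd d
... | K , inj₁ d≡2K = K , inj₂ (cong suc d≡2K)
... | K , inj₂ d≡2K+1 = suc K , inj₁ (trans (cong suc d≡2K+1) (cong suc (sym (ℕP.+-suc K K))))

trinomialTerm : ℕ → ℕ → ℤ → ℤ → ℕ → Series
trinomialTerm L M a b n =
  mono (n ℕ.* n) ⊛ (gauss (+ M) (+ n) ⊛ (gauss (+ M + b + half (+ L - a - + n)) (+ M + b)
                                      ⊛ gauss (+ M - b + half (+ L + a - + n)) (+ M - b)))

-- Definitionally the summand in the definition of T, so T≡∑ is a mere change of fold.
Tsummand : ℕ → ℕ → ℤ → ℤ → ℕ → Series
Tsummand L M a b n = if isEven (+ n + a + + L) then trinomialTerm L M a b n else zeroS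

T≡∑ : ∀ L M a b → T (+ L) (+ M) a b ≡ ∑ (suc L) (Tsummand L M a b)
T≡∑ L M a b = foldr-map-applyUpTo addS zeroS (Tsummand L M a b) (λ i → i) (suc L)

nTerm : ℕ → ℕ → ℕ → ℤ → Series
nTerm L M n j = q^ ∣ j * (j + 1ℤ) ∣ ⊛ (Tsummand L M (+ 2 * j) j n ⊖ Tsummand L M (+ 2 * j + + 2) j n)

summandJ≈∑ : ∀ L M j → summandJ L M j ≈ ∑ (suc L) (λ n → nTerm L M n j)
summandJ≈∑ L M j = begin
  summandJ L M j
    ≡⟨ cong (λ x → q^ ∣ j * (j + 1ℤ) ∣ ⊛ x) (cong₂ _⊖_ (T≡∑ L M (+ 2 * j) j) (T≡∑ L M (+ 2 * j + + 2) j)) ⟩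
  q^ ∣ j * (j + 1ℤ) ∣ ⊛ (∑ (suc L) (Tsummand L M (+ 2 * j) j) ⊖ ∑ (suc L) (Tsummand L M (+ 2 * j + + 2) j))
    ≈⟨ *-congˡ {q^ ∣ j * (j + 1ℤ) ∣} (∑-⊖ (suc L) (Tsummand L M (+ 2 * j) j) (Tsummand L M (+ 2 * j + + 2) j)) ⟩
  q^ ∣ j * (j + 1ℤ) ∣ ⊛ ∑ (suc L) (λ n → Tsummand L M (+ 2 * j) j n ⊖ Tsummand L M (+ 2 * j + + 2) j n)
    ≈⟨ ⊕Σ.*-distribˡ-sum {suc L} (q^ ∣ j * (j + 1ℤ) ∣)
                         (λ n → Tsummand L M (+ 2 * j) j (toℕ n) ⊖ Tsummand L M (+ 2 * j + + 2) j (toℕ n)) ⟩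
  ∑ (suc L) (λ n → nTerm L M n j) ∎

Tsummand-odd : ∀ L M n a b w → + n + a + + L ≡ 1ℤ + (w + w) → Tsummand L M a b n ≡ zeroS
Tsummand-odd L M n a b w parity =
  cong (λ c → if c then trinomialTerm L M a b n else zeroS) (trans (cong isEven parity) (isEven-1+double w))

Tsummand-even : ∀ L M n a b w h₁ h₂ →
  + n + a + + L ≡ w + w → + L - a - + n ≡ h₁ + h₁ → + L + a - + n ≡ h₂ + h₂ →
  Tsummand L M a b n ≡
    mono (n ℕ.* n) ⊛ (gauss (+ M) (+ n) ⊛ (gauss (+ M + b + h₁) (+ M + b) ⊛ gauss (+ M - b + h₂) (+ M - b)))
Tsummand-even L M n a b w h₁ h₂ parity half₁ half₂ = trans
  (cong (λ c → if c then trinomialTerm L M a b n else zeroS) (trans (cong isEven parity) (isEven-double w)))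
  (cong₂ (λ x y → mono (n ℕ.* n) ⊛ (gauss (+ M) (+ n) ⊛ (gauss (+ M + b + x) (+ M + b) ⊛ gauss (+ M - b + y) (+ M - b))))
         (trans (cong half half₁) (half-double h₁)) (trans (cong half half₂) (half-double h₂)))

nTerm-odd : ∀ M n K j → nTerm (n ℕ.+ suc (double K)) M n j ≈ zeroS
nTerm-odd M n K j = ⊛-zeroʳ-cong (q^ ∣ j * (j + 1ℤ) ∣) (≈-reflexive (cong₂ _⊖_
  (Tsummand-odd (n ℕ.+ suc (double K)) M n (+ 2 * j) j (+ n + + K + j) (parity₀ (+ n) j (+ K)))
  (Tsummand-odd (n ℕ.+ suc (double K)) M n (+ 2 * j + + 2) j (+ n + + K + j + 1ℤ) (parity₂ (+ n) j (+ K)))))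
  where
  parity₀ : ∀ n j K → n + + 2 * j + (n + (1ℤ + (K + K))) ≡ 1ℤ + ((n + K + j) + (n + K + j))
  parity₀ = solve-∀
  parity₂ : ∀ n j K → n + (+ 2 * j + + 2) + (n + (1ℤ + (K + K))) ≡ 1ℤ + ((n + K + j + 1ℤ) + (n + K + j + 1ℤ))
  parity₂ = solve-∀

Tsummand-2j : ∀ M n K j → Tsummand (n ℕ.+ double K) M (+ 2 * j) j n ≡
  mono (n ℕ.* n) ⊛ (gauss (+ M) (+ n) ⊛ (gauss (+ (M ℕ.+ K)) (+ M + j) ⊛ gauss (+ (M ℕ.+ K)) (+ M - j)))
Tsummand-2j M n K j = trans
  (Tsummand-even (n ℕ.+ double K) M n (+ 2 * j) j (+ n + + K + j) (+ K - j) (+ K + j)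
    (parity (+ n) j (+ K)) (half₁ (+ n) j (+ K)) (half₂ (+ n) j (+ K)))
  (cong₂ (λ A B → mono (n ℕ.* n) ⊛ (gauss (+ M) (+ n) ⊛ (gauss A (+ M + j) ⊛ gauss B (+ M - j))))
         (upper₁ (+ M) j (+ K)) (upper₂ (+ M) j (+ K)))
  where
  parity : ∀ n j K → n + + 2 * j + (n + (K + K)) ≡ (n + K + j) + (n + K + j)
  parity = solve-∀
  half₁ : ∀ n j K → (n + (K + K)) - + 2 * j - n ≡ (K - j) + (K - j)
  half₁ = solve-∀
  half₂ : ∀ n j K → (n + (K + K)) + + 2 * j - n ≡ (K + j) + (K + j)
  half₂ = solve-∀
  upper₁ : ∀ M j K → M + j + (K - j) ≡ M + K
  upper₁ = solve-∀
  upper₂ : ∀ M j K → M - j + (K + j) ≡ M + K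
  upper₂ = solve-∀

Tsummand-2j+2 : ∀ M n K j → Tsummand (n ℕ.+ double K) M (+ 2 * j + + 2) j n ≡
  mono (n ℕ.* n) ⊛ (gauss (+ M) (+ n) ⊛ (gauss (+ (M ℕ.+ K) - 1ℤ) (+ M + j) ⊛ gauss (+ suc (M ℕ.+ K)) (+ M - j)))
Tsummand-2j+2 M n K j = trans
  (Tsummand-even (n ℕ.+ double K) M n (+ 2 * j + + 2) j (+ n + + K + j + 1ℤ) (+ K - j - 1ℤ) (+ K + j + 1ℤ)
    (parity (+ n) j (+ K)) (half₁ (+ n) j (+ K)) (half₂ (+ n) j (+ K)))
  (cong₂ (λ A B → mono (n ℕ.* n) ⊛ (gauss (+ M) (+ n) ⊛ (gauss A (+ M + j) ⊛ gauss B (+ M - j))))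
         (upper₁ (+ M) j (+ K)) (upper₂ (+ M) j (+ K)))
  where
  parity : ∀ n j K → n + (+ 2 * j + + 2) + (n + (K + K)) ≡ (n + K + j + 1ℤ) + (n + K + j + 1ℤ)
  parity = solve-∀
  half₁ : ∀ n j K → (n + (K + K)) - (+ 2 * j + + 2) - n ≡ (K - j - 1ℤ) + (K - j - 1ℤ)
  half₁ = solve-∀
  half₂ : ∀ n j K → (n + (K + K)) + (+ 2 * j + + 2) - n ≡ (K + j + 1ℤ) + (K + j + 1ℤ)
  half₂ = solve-∀
  upper₁ : ∀ M j K → M + j + (K - j - 1ℤ) ≡ M + K - 1ℤ
  upper₁ = solve-∀
  upper₂ : ∀ M j K → M - j + (K + j + 1ℤ) ≡ 1ℤ + (M + K)
  upper₂ = solve-∀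

nWeight : ℕ → ℕ → Series
nWeight M n = mono (n ℕ.* n) ⊛ gauss (+ M) (+ n)

nTerm-even : ∀ M n K j → nTerm (n ℕ.+ double K) M n j ≈ nWeight M n ⊛ jTerm (M ℕ.+ K) M j
nTerm-even M n K j = begin
  nTerm (n ℕ.+ double K) M n j
    ≡⟨ cong (q^ ∣ j * (j + 1ℤ) ∣ ⊛_) (cong₂ _⊖_ (Tsummand-2j M n K j) (Tsummand-2j+2 M n K j)) ⟩
  q^ ∣ j * (j + 1ℤ) ∣ ⊛ (m ⊛ (g ⊛ (x ⊛ y)) ⊖ m ⊛ (g ⊛ (x′ ⊛ z)))
    ≈⟨ solve 7 (λ q m g x y x′ z → q :* (m :* (g :* (x :* y)) :- m :* (g :* (x′ :* z)))
                                 := (m :* g) :* (q :* (x :* y :- x′ :* z)))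
             ≈-refl (q^ ∣ j * (j + 1ℤ) ∣) m g x y x′ z ⟩
  nWeight M n ⊛ jTerm (M ℕ.+ K) M j ∎
  where
  m = mono (n ℕ.* n)
  g = gauss (+ M) (+ n)
  x = gauss (+ (M ℕ.+ K)) (+ M + j)
  y = gauss (+ (M ℕ.+ K)) (+ M - j)
  x′ = gauss (+ (M ℕ.+ K) - 1ℤ) (+ M + j)
  z = gauss (+ suc (M ℕ.+ K)) (+ M - j)

partialSum-nTerm-even : ∀ M n K K₁ K₂ →
  partialSum (nTerm (n ℕ.+ double K) M n) K₁ K₂ ≈ nWeight M n ⊛ partialSum (jTerm (M ℕ.+ K) M) K₁ K₂
partialSum-nTerm-even M n K K₁ K₂ =
  ≈-trans (partialSum-cong K₁ K₂ (nTerm-even M n K)) (partialSum-⊛ (nWeight M n) (jTerm (M ℕ.+ K) M) K₁ K₂)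

nWeight-vanishes : ∀ M n → M ≡ 0 → (n ≡ 0 → ⊥) → nWeight M n ≈ zeroS
nWeight-vanishes .0 zero    refl n≢0 = ⊥-elim (n≢0 refl)
nWeight-vanishes .0 (suc n) refl _   = ⊛-zeroʳ-cong (mono (suc n ℕ.* suc n)) (gauss-lower>upper {0} {suc n} (ℕ.s≤s ℕ.z≤n))

partialSum-nTerm-even-vanishes : ∀ M n K K₁ K₂ → M ℕ.≤ K₁ → M ℕ.≤ K₂ →
  (M ≡ 0 → n ℕ.+ double K ≡ 0 → ⊥) →
  partialSum (nTerm (n ℕ.+ double K) M n) K₁ K₂ ≈ zeroS
partialSum-nTerm-even-vanishes M n K K₁ K₂ M≤K₁ M≤K₂ not-origin =
  ≈-trans (partialSum-nTerm-even M n K K₁ K₂) (vanishes (M ℕ.+ K) refl)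
  where
  vanishes : ∀ P → P ≡ M ℕ.+ K → nWeight M n ⊛ partialSum (jTerm P M) K₁ K₂ ≈ zeroS
  vanishes (suc p) P≡M+K = ⊛-zeroʳ-cong (nWeight M n) (partialSum-jTerm-vanishes p M K K₁ K₂ P≡M+K M≤K₁ M≤K₂)
  vanishes zero    0≡M+K = ≈-trans
    (*-congʳ {partialSum (jTerm 0 M) K₁ K₂}
      (nWeight-vanishes M n M≡0 λ n≡0 → not-origin M≡0 (cong₂ (λ n K → n ℕ.+ double K) n≡0 K≡0)))
    (zeroˡ (partialSum (jTerm 0 M) K₁ K₂))
    where
    M≡0 = ℕP.m+n≡0⇒m≡0 M (sym 0≡M+K)
    K≡0 = ℕP.m+n≡0⇒n≡0 M (sym 0≡M+K)

partialSum-nTerm-vanishes : ∀ L M n K₁ K₂ → M ℕ.≤ K₁ → M ℕ.≤ K₂ → n ℕ.≤ L →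
  (M ≡ 0 → L ≡ 0 → ⊥) →
  partialSum (nTerm L M n) K₁ K₂ ≈ zeroS
partialSum-nTerm-vanishes L M n K₁ K₂ M≤K₁ M≤K₂ n≤L not-origin with even-or-odd (L ∸ n)
... | K , inj₁ L-n≡2K = subst (λ L → partialSum (nTerm L M n) K₁ K₂ ≈ zeroS) L≡n+2K
  (partialSum-nTerm-even-vanishes M n K K₁ K₂ M≤K₁ M≤K₂
    λ M≡0 n+2K≡0 → not-origin M≡0 (trans (sym L≡n+2K) n+2K≡0))
  where L≡n+2K = trans (cong (n ℕ.+_) (sym L-n≡2K)) (ℕP.m+[n∸m]≡n n≤L)
... | K , inj₂ L-n≡2K+1 = subst (λ L → partialSum (nTerm L M n) K₁ K₂ ≈ zeroS)
  (trans (cong (n ℕ.+_) (sym L-n≡2K+1)) (ℕP.m+[n∸m]≡n n≤L)) (partialSum-zero K₁ K₂ (nTerm-odd M n K))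

partialSum-nTerm-origin : ∀ K₁ K₂ → partialSum (nTerm 0 0 0) K₁ K₂ ≈ oneS
partialSum-nTerm-origin K₁ K₂ = begin
  partialSum (nTerm 0 0 0) K₁ K₂
    ≈⟨ partialSum-nTerm-even 0 0 0 K₁ K₂ ⟩
  nWeight 0 0 ⊛ partialSum (jTerm 0 0) K₁ K₂
    ≈⟨ *-cong (*-cong mono-zero (gauss-zero-index 0)) (partialSum-jTerm-zero K₁ K₂) ⟩
  oneS ⊛ oneS ⊛ oneS
    ≈⟨ ≈-trans (*-identityʳ (oneS ⊛ oneS)) (*-identityˡ oneS) ⟩
  oneS ∎

∑-partialSum-nTerm : ∀ L M K₁ K₂ → M ℕ.≤ K₁ → M ℕ.≤ K₂ →
  ∑ (suc L) (λ n → partialSum (nTerm L M n) K₁ K₂) ≈ deltaS L M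
∑-partialSum-nTerm zero    zero    K₁ K₂ _ _ =
  ≈-trans (+-identityʳ (partialSum (nTerm 0 0 0) K₁ K₂)) (partialSum-nTerm-origin K₁ K₂)
∑-partialSum-nTerm zero    (suc M) K₁ K₂ M≤K₁ M≤K₂ = ∑-zero 1 _ λ n n<1 →
  partialSum-nTerm-vanishes 0 (suc M) n K₁ K₂ M≤K₁ M≤K₂ (ℕP.≤-pred n<1) λ ()
∑-partialSum-nTerm (suc L) M       K₁ K₂ M≤K₁ M≤K₂ = ∑-zero (suc (suc L)) _ λ n n<L+2 →
  partialSum-nTerm-vanishes (suc L) M n K₁ K₂ M≤K₁ M≤K₂ (ℕP.≤-pred n<L+2) λ _ ()

partialSum-summandJ : ∀ L M K₁ K₂ → M ℕ.≤ K₁ → M ℕ.≤ K₂ → partialSum (summandJ L M) K₁ K₂ ≈ deltaS L M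
partialSum-summandJ L M K₁ K₂ M≤K₁ M≤K₂ = begin
  partialSum (summandJ L M) K₁ K₂
    ≈⟨ partialSum-cong K₁ K₂ (summandJ≈∑ L M) ⟩
  partialSum (λ j → ∑ (suc L) (λ n → nTerm L M n j)) K₁ K₂
    ≈⟨ partialSum-∑ (suc L) (nTerm L M) K₁ K₂ ⟩
  ∑ (suc L) (λ n → partialSum (nTerm L M n) K₁ K₂)
    ≈⟨ ∑-partialSum-nTerm L M K₁ K₂ M≤K₁ M≤K₂ ⟩
  deltaS L M ∎

lemma4p1 : (L M : ℕ) → SumsTo (summandJ L M) (deltaS L M)
lemma4p1 L M e = M , λ K₁ K₂ M≤K₁ M≤K₂ → coeff (partialSum-summandJ L M K₁ K₂ M≤K₁ M≤K₂) e
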